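{- Let $d$ be a positive integer, $a$ an integer with $0\leq a\leq d-1$, and $n$ a nonnegative integer with $n\leq d/2$. Let $P_d^{a,a+1}$ be the subposet of $2^d$ consisting of those elements in which the number of coordinates equal to $1$ is either $a$ or $a+1$. Then for every family of chains $(C_j)_{j\in\{0,\dots,n-1\}}$, $$\dim\Big(P_d^{a,a+1}\times\prod_{j=0}^{n-1} C_j\Big)\ \leq\ d.$$
   Context: All posets (in particular chains) are nonempty; products of posets carry the componentwise order, and the empty product is a one-point poset. $2$ denotes the chain $\{0,1\}$ with $0<1$ and $2^d$ the $d$-fold product. The dimension $\dim(Q)$ of a poset $Q$ is the least cardinal $\kappa$ such that $Q$ order-embeds into a product of $\kappa$ chains (equivalently, the order of $Q$ is an intersection of $\kappa$ total orders on its underlying set). -}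

module Defs where

open import Level using (Level; _⊔_)
open import Data.Nat using (ℕ; suc)
open import Data.Fin using (Fin)
open import Data.Fin.Subset using (Subset; _⊆_; ∣_∣)
open import Data.Product using (Σ; _×_; proj₁; proj₂)
open import Data.Sum using (_⊎_)
open import Relation.Binary.PropositionalEquality using (_≡_)
open import Relation.Binary.Bundles using (TotalOrder)
open import Function.Bundles using (_⇔_)

record PosetData (c ℓ : Level) : Set (Level.suc (c ⊔ ℓ)) where
  field
    Carrier : Set c
    _≤_     : Carrier → Carrier → Set ℓ

_⊗_ : ∀ {c₁ ℓ₁ c₂ ℓ₂} → PosetData c₁ ℓ₁ → PosetData c₂ ℓ₂ → PosetData (c₁ ⊔ c₂) (ℓ₁ ⊔ ℓ₂)
P ⊗ Q = record
  { Carrier = PosetData.Carrier P × PosetData.Carrier Q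
  ; _≤_ = λ x y → PosetData._≤_ P (proj₁ x) (proj₁ y) × PosetData._≤_ Q (proj₂ x) (proj₂ y)
  }

ΠChains : ∀ {c ℓ₁ ℓ₂} (n : ℕ) → (Fin n → TotalOrder c ℓ₁ ℓ₂) → PosetData c ℓ₂
ΠChains n C = record
  { Carrier = (j : Fin n) → TotalOrder.Carrier (C j)
  ; _≤_ = λ x y → (j : Fin n) → TotalOrder._≤_ (C j) (x j) (y j)
  }

-- P_d^{a,a+1}: subsets of {0..d-1} (= elements of 2^d) with a or a+1 elements,
-- ordered by inclusion (= componentwise order on 2^d).
P : (d a : ℕ) → PosetData Level.zero Level.zero
P d a = record
  { Carrier = Σ (Subset d) (λ s → (∣ s ∣ ≡ a) ⊎ (∣ s ∣ ≡ suc a))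
  ; _≤_ = λ x y → proj₁ x ⊆ proj₁ y
  }

-- dim(Q) ≤ k : Q order-embeds into a product of k chains
-- (chains taken with carriers/relations at the given level ℓ).
DimAtMost : ∀ {c ℓ} (ℓ' : Level) → PosetData c ℓ → ℕ → Set (c ⊔ ℓ ⊔ Level.suc ℓ')
DimAtMost ℓ' Q k =
  Σ (Fin k → TotalOrder ℓ' ℓ' ℓ') λ L →
  Σ (PosetData.Carrier Q → (i : Fin k) → TotalOrder.Carrier (L i)) λ f →
  ∀ x y → PosetData._≤_ Q x y ⇔ ((i : Fin k) → TotalOrder._≤_ (L i) (f x i) (f y i))

-- Give coordinate i of 2^d the lexicographic chain 2 ×ₗ C_j, where every chain C_j is
-- attached to two distinct coordinates (possible as 2n ≤ d) and the remaining coordinates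
-- carry a one-point chain, and send (s , v) to (i ↦ (s_i , v_j)). Coordinatewise domination
-- of images gives s ⊆ t from the first components, and v_j ≤ w_j unless the first component
-- jumps from 0 to 1 at both coordinates attached to j; but then t has two elements outside s,
-- impossible when all sizes lie in {a, a+1}.
module Submission where

open import Defs
open import Level using (Level; _⊔_; Lift; lift; lower)
open import Data.Nat using (ℕ; _≤_; _<_; _*_)
open import Data.Fin using (Fin)
open import Relation.Binary.Bundles using (TotalOrder)

open import Data.Bool.Base as Bool using (f≤t; b≤b; f<t)
open import Data.Bool.Properties using (≤-decTotalOrder)
open import Data.Fin.Base using (zero; suc; _↑ˡ_; _↑ʳ_; splitAt)
open import Data.Fin.Properties using (splitAt-↑ˡ; splitAt-↑ʳ)
open import Data.Fin.Subset using (Subset; _⊆_; _⊂_; _∈_; _∉_; ∣_∣; _-_; inside; outside)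
open import Data.Fin.Subset.Properties
  using (drop-∷-⊆; drop-there; p⊂q⇒∣p∣<∣q∣; x∈p⇒∣p-x∣<∣p∣; x∈p∧x≢y⇒x∈p-y)
open import Data.Maybe.Base using (Maybe; just; nothing)
open import Data.Nat using (suc; s≤s; _+_; _∸_)
open import Data.Nat.Properties
  using (≤-refl; ≤-trans; n≤1+n; ≤⇒≯; +-assoc; +-identityʳ; m+[n∸m]≡n)
open import Data.Product.Base using (Σ; _×_; _,_; proj₁)
open import Data.Product.Relation.Binary.Lex.NonStrict using (×-totalOrder)
open import Data.Sum.Base using (_⊎_; inj₁; inj₂; [_,_]; map)
open import Data.Unit.Polymorphic.Base using (tt)
open import Data.Unit.Polymorphic.Properties using (≡-totalOrder)
open import Data.Vec.Base using (lookup; _∷_; here; there)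
open import Function.Base using (_∘_; const)
open import Function.Bundles using (mk⇔)
open import Relation.Binary.PropositionalEquality
  using (_≡_; _≢_; refl; sym; trans; cong; subst; module ≡-Reasoning)
open import Relation.Nullary.Negation using (contradiction)

liftTotalOrder : ∀ {c ℓ₁ ℓ₂} ℓ → TotalOrder c ℓ₁ ℓ₂ → TotalOrder (c ⊔ ℓ) (ℓ₁ ⊔ ℓ) (ℓ₂ ⊔ ℓ)
liftTotalOrder ℓ O = record
  { Carrier = Lift ℓ O.Carrier
  ; _≈_ = λ x y → Lift ℓ (lower x O.≈ lower y)
  ; _≤_ = λ x y → Lift ℓ (lower x O.≤ lower y)
  ; isTotalOrder = record
    { isPartialOrder = record
      { isPreorder = record
        { isEquivalence = record
          { refl = lift O.Eq.refl
          ; sym = λ x≈y → lift (O.Eq.sym (lower x≈y))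
          ; trans = λ x≈y y≈z → lift (O.Eq.trans (lower x≈y) (lower y≈z))
          }
        ; reflexive = λ x≈y → lift (O.reflexive (lower x≈y))
        ; trans = λ x≤y y≤z → lift (O.trans (lower x≤y) (lower y≤z))
        }
      ; antisym = λ x≤y y≤x → lift (O.antisym (lower x≤y) (lower y≤x))
      }
    ; total = λ x y → map lift lift (O.total (lower x) (lower y))
    }
  }
  where module O = TotalOrder O

module _ {c ℓ₁ ℓ₂} (D : TotalOrder c ℓ₁ ℓ₂) where
  private module D = TotalOrder D

  Bool×ₗ_ : TotalOrder c ℓ₁ ℓ₂
  Bool×ₗ_ = ×-totalOrder ≤-decTotalOrder D

  open TotalOrder Bool×ₗ_ using () renaming (_≤_ to _≤ₗₑₓ_)

  ≤ₗₑₓ-intro : ∀ {b b′ x y} → b Bool.≤ b′ → x D.≤ y → (b , x) ≤ₗₑₓ (b′ , y)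
  ≤ₗₑₓ-intro f≤t _   = inj₁ (f≤t , λ ())
  ≤ₗₑₓ-intro b≤b x≤y = inj₂ (refl , x≤y)

  ≤ₗₑₓ⇒≤₁ : ∀ {b b′ x y} → (b , x) ≤ₗₑₓ (b′ , y) → b Bool.≤ b′
  ≤ₗₑₓ⇒≤₁ (inj₁ (b≤b′ , _)) = b≤b′
  ≤ₗₑₓ⇒≤₁ (inj₂ (refl , _)) = b≤b

  ≤ₗₑₓ⇒<₁⊎≤₂ : ∀ {b b′ x y} → (b , x) ≤ₗₑₓ (b′ , y) → b Bool.< b′ ⊎ x D.≤ y
  ≤ₗₑₓ⇒<₁⊎≤₂ (inj₁ (f≤t , _))   = inj₁ f<t
  ≤ₗₑₓ⇒<₁⊎≤₂ (inj₁ (b≤b , b≢b)) = contradiction refl b≢b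
  ≤ₗₑₓ⇒<₁⊎≤₂ (inj₂ (_ , x≤y))   = inj₂ x≤y

⊆⇒lookup≤ : ∀ {n} {p q : Subset n} → p ⊆ q → ∀ i → lookup p i Bool.≤ lookup q i
⊆⇒lookup≤ {p = outside ∷ _} {outside ∷ _} _ zero = b≤b
⊆⇒lookup≤ {p = outside ∷ _} {inside ∷ _} _ zero = f≤t
⊆⇒lookup≤ {p = inside ∷ _} p⊆q zero with p⊆q here
... | here = b≤b
⊆⇒lookup≤ {p = _ ∷ _} {_ ∷ _} p⊆q (suc i) = ⊆⇒lookup≤ (drop-∷-⊆ p⊆q) i

lookup≤⇒⊆ : ∀ {n} {p q : Subset n} → (∀ i → lookup p i Bool.≤ lookup q i) → p ⊆ q
lookup≤⇒⊆ {q = _ ∷ _} p≤q here with p≤q zero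
... | b≤b = here
lookup≤⇒⊆ {p = _ ∷ _} {_ ∷ _} p≤q (there i∈p) = there (lookup≤⇒⊆ (p≤q ∘ suc) i∈p)

lookup<⇒∉×∈ : ∀ {n} {p q : Subset n} {i} → lookup p i Bool.< lookup q i → i ∉ p × i ∈ q
lookup<⇒∉×∈ {p = outside ∷ _} {inside ∷ _} {zero} f<t = (λ ()) , here
lookup<⇒∉×∈ {p = _ ∷ _} {_ ∷ _} {suc i} p[i]<q[i] =
  let i∉p , i∈q = lookup<⇒∉×∈ p[i]<q[i] in i∉p ∘ drop-there , there i∈q

2+∣p∣≤∣q∣ : ∀ {n} {p q : Subset n} {i j} → p ⊆ q → i ≢ j →
            i ∉ p → i ∈ q → j ∉ p → j ∈ q → 2 + ∣ p ∣ ≤ ∣ q ∣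
2+∣p∣≤∣q∣ {p = p} {q} {i} {j} p⊆q i≢j i∉p i∈q j∉p j∈q =
  ≤-trans (s≤s (p⊂q⇒∣p∣<∣q∣ p⊂q-j)) (x∈p⇒∣p-x∣<∣p∣ j∈q)
  where
  p⊆q-j : p ⊆ q - j
  p⊆q-j x∈p = x∈p∧x≢y⇒x∈p-y (p⊆q x∈p) λ { refl → j∉p x∈p }
  p⊂q-j : p ⊂ q - j
  p⊂q-j = p⊆q-j , i , x∈p∧x≢y⇒x∈p-y i∈q i≢j , i∉p

SubsetPoset : ∀ {ℓ} (d : ℕ) → (Subset d → Set ℓ) → PosetData ℓ Level.zero
SubsetPoset d A = record
  { Carrier = Σ (Subset d) A
  ; _≤_ = λ x y → proj₁ x ⊆ proj₁ y
  }

Thin : ∀ {ℓ d} → (Subset d → Set ℓ) → Set ℓ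
Thin A = ∀ {s t} → A s → A t → s ⊆ t → ∣ t ∣ ≤ suc ∣ s ∣

twoLevels-thin : ∀ {d} a → Thin {d = d} (λ s → ∣ s ∣ ≡ a ⊎ ∣ s ∣ ≡ suc a)
twoLevels-thin a ∣s∣∈ ∣t∣∈ _ = ≤-trans (k≤1+a ∣t∣∈) (s≤s (a≤k ∣s∣∈))
  where
  a≤k : ∀ {k} → k ≡ a ⊎ k ≡ suc a → a ≤ k
  a≤k (inj₁ refl) = ≤-refl
  a≤k (inj₂ refl) = n≤1+n a
  k≤1+a : ∀ {k} → k ≡ a ⊎ k ≡ suc a → k ≤ suc a
  k≤1+a (inj₁ refl) = n≤1+n a
  k≤1+a (inj₂ refl) = ≤-refl

record TwoFoldCover (d n : ℕ) : Set where
  field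
    label         : Fin d → Maybe (Fin n)
    first second  : Fin n → Fin d
    first≢second  : ∀ j → first j ≢ second j
    label-first   : ∀ j → label (first j) ≡ just j
    label-second  : ∀ j → label (second j) ≡ just j

twoFoldCover-+ : ∀ n r → TwoFoldCover (n + (n + r)) n
twoFoldCover-+ n r = record
  { label = [ just , [ just , const nothing ] ∘ splitAt n ] ∘ splitAt n
  ; first = λ j → j ↑ˡ (n + r)
  ; second = λ j → n ↑ʳ (j ↑ˡ r)
  ; first≢second = λ j eq → contradiction
      (trans (sym (splitAt-↑ˡ n j (n + r))) (trans (cong (splitAt n) eq) (splitAt-↑ʳ n (n + r) (j ↑ˡ r))))
      λ ()
  ; label-first = λ j → cong [ just , _ ] (splitAt-↑ˡ n j (n + r))
  ; label-second = λ j → trans (cong [ _ , [ just , _ ] ∘ splitAt n ] (splitAt-↑ʳ n (n + r) (j ↑ˡ r)))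
                               (cong [ just , _ ] (splitAt-↑ˡ n j r))
  }

twoFoldCover : ∀ {d n} → 2 * n ≤ d → TwoFoldCover d n
twoFoldCover {d} {n} 2n≤d = subst (λ d → TwoFoldCover d n) n+[n+r]≡d (twoFoldCover-+ n r)
  where
  open ≡-Reasoning
  r = d ∸ 2 * n
  n+[n+r]≡d : n + (n + r) ≡ d
  n+[n+r]≡d = begin
    n + (n + r)        ≡⟨ +-assoc n n r ⟨
    n + n + r          ≡⟨ cong (λ k → n + k + r) (+-identityʳ n) ⟨
    2 * n + r          ≡⟨ m+[n∸m]≡n 2n≤d ⟩
    d                  ∎

module _ {ℓ c ℓ₁ ℓ₂ d n} {A : Subset d → Set ℓ} (thin : Thin A) (cover : TwoFoldCover d n)
         (C : Fin n → TotalOrder c ℓ₁ ℓ₂) where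
  open TwoFoldCover cover
  private
    L = c ⊔ ℓ₁ ⊔ ℓ₂
    Q = SubsetPoset d A ⊗ ΠChains n C
    Point = (j : Fin n) → TotalOrder.Carrier (C j)

  chainAt : Maybe (Fin n) → TotalOrder L L L
  chainAt (just j) = liftTotalOrder L (C j)
  chainAt nothing  = ≡-totalOrder L

  valueAt : (m : Maybe (Fin n)) → Point → TotalOrder.Carrier (chainAt m)
  valueAt (just j) v = lift (v j)
  valueAt nothing  _ = tt

  valueAt-mono : ∀ m {v w : Point} → (∀ j → TotalOrder._≤_ (C j) (v j) (w j)) →
                 TotalOrder._≤_ (chainAt m) (valueAt m v) (valueAt m w)
  valueAt-mono (just j) v≤w = lift (v≤w j)
  valueAt-mono nothing  _   = refl

  valueAt-reflects : ∀ {m j} {v w : Point} → m ≡ just j →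
                     TotalOrder._≤_ (chainAt m) (valueAt m v) (valueAt m w) →
                     TotalOrder._≤_ (C j) (v j) (w j)
  valueAt-reflects refl = lower

  coordinate : Fin d → TotalOrder L L L
  coordinate i = Bool×ₗ chainAt (label i)

  embed : PosetData.Carrier Q → (i : Fin d) → TotalOrder.Carrier (coordinate i)
  embed ((s , _) , v) i = lookup s i , valueAt (label i) v

  _≤ᵉ_ : PosetData.Carrier Q → PosetData.Carrier Q → Set L
  x ≤ᵉ y = (i : Fin d) → TotalOrder._≤_ (coordinate i) (embed x i) (embed y i)

  embed-mono : ∀ x y → PosetData._≤_ Q x y → x ≤ᵉ y
  embed-mono ((s , _) , v) ((t , _) , w) (s⊆t , v≤w) i =
    ≤ₗₑₓ-intro (chainAt (label i)) (⊆⇒lookup≤ s⊆t i) (valueAt-mono (label i) v≤w)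

  embed-reflects : ∀ x y → x ≤ᵉ y → PosetData._≤_ Q x y
  embed-reflects ((s , As) , v) ((t , At) , w) s,v≤t,w = s⊆t , v≤w
    where
    s⊆t : s ⊆ t
    s⊆t = lookup≤⇒⊆ λ i → ≤ₗₑₓ⇒≤₁ (chainAt (label i)) (s,v≤t,w i)

    v≤w : ∀ j → TotalOrder._≤_ (C j) (v j) (w j)
    v≤w j with ≤ₗₑₓ⇒<₁⊎≤₂ (chainAt (label (first j))) (s,v≤t,w (first j))
             | ≤ₗₑₓ⇒<₁⊎≤₂ (chainAt (label (second j))) (s,v≤t,w (second j))
    ... | inj₂ v≤w₁ | _         = valueAt-reflects (label-first j) v≤w₁
    ... | _         | inj₂ v≤w₂ = valueAt-reflects (label-second j) v≤w₂
    ... | inj₁ s<t₁ | inj₁ s<t₂ =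
      let i∉s , i∈t = lookup<⇒∉×∈ s<t₁
          i′∉s , i′∈t = lookup<⇒∉×∈ s<t₂
      in contradiction (2+∣p∣≤∣q∣ s⊆t (first≢second j) i∉s i∈t i′∉s i′∈t) (≤⇒≯ (thin As At s⊆t))

  thin×chains-dim≤ : DimAtMost L Q d
  thin×chains-dim≤ = coordinate , embed , λ x y → mk⇔ (embed-mono x y) (embed-reflects x y)

corollary2p4 : ∀ {c ℓ₁ ℓ₂ : Level} (d a n : ℕ) → 1 ≤ d → a < d → 2 * n ≤ d →
    (C : Fin n → TotalOrder c ℓ₁ ℓ₂) → ((j : Fin n) → TotalOrder.Carrier (C j)) →
    DimAtMost (c ⊔ ℓ₁ ⊔ ℓ₂) (P d a ⊗ ΠChains n C) d
corollary2p4 d a n _ _ 2n≤d C _ = thin×chains-dim≤ (twoLevels-thin a) (twoFoldCover 2n≤d) C
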